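{- For every run of the roundabout exploration process and every $t\in[N]$, we have $\sum_{a_i\in A(t)}|D_i(t)|\le 2N-|A(t)|$.
   Context: Let $n\ge2$ and $k\ge1$ be integers, and let $T$ be a tree on a vertex set $V$ with $|V|=n$, rooted at $r$. DFS tour. Fix a depth-first-search tour of $T$ that starts and ends at $r$ and traverses each edge of $T$ exactly twice. Write it as $(v_1,\dots,v_N,v_{N+1})$ with $v_1=v_{N+1}=r$ and $N=2(n-1)$, and put $e_i=\{v_i,v_{i+1}\}$ for $i\in[N]$. Circular intervals. For $i,j\in[N]$, let $[i,j]=\{i,\dots,j\}$ if $i\le j$, and $[i,j]=\{i,\dots,N,1,\dots,j\}$ if $i>j$. Snapshots. Let $G_1,\dots,G_N$ be graphs on $V$, each containing all but at most $k$ edges of $T$. Roundabout exploration process. There are agents $a_1,\dots,a_N$ with initial states $s_i(0)=i$. Set $D_i(0)=\{i\}$ and $A(0)=\{a_1,\dots,a_N\}$. For $t=1,\dots,N$ do: (1) Movement: if $s_i(t-1)=q$, then $s_i(t)=(q\bmod N)+1$ if $e_q\in E(G_t)$, and $s_i(t)=q$ otherwise. (2) Elimination: let $D_i(t)=[i,s_i(t)]$. Starting from $A(t-1)$, repeatedly remove an arbitrary agent $a_i$ of the current set with $D_i(t)\subseteq\bigcup_{a_j\text{ in current set},\,j\neq i}D_j(t)$, until no such agent remains. The result is $A(t)$. A run is any execution of this process, i.e. any choice of removed agents. -}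

module Defs where

open import Data.Bool using (Bool; true; false; if_then_else_; _∧_; _∨_; not)
open import Data.Nat using (ℕ; zero; suc; _+_; _*_; _∸_; _≤_; _<_; _≤?_; _<?_)
open import Data.Nat.DivMod using (_%_; m%n<n)
open import Data.Fin using (Fin; toℕ; fromℕ<; fromℕ; inject₁) renaming (zero to fzero; suc to fsuc)
open import Data.Fin.Properties using () renaming (_≟_ to _≟ᶠ_)
open import Data.Fin.Subset using (Subset; _∈_; _⊆_; ⋃; _-_; ⊤)
open import Data.Fin.Subset.Properties using (_∈?_)
open import Data.List using (List; filter; map; allFin)
open import Data.Nat.ListAction using (sum)
open import Data.Vec using (tabulate; lookup)
open import Data.Product using (Σ; _×_; _,_)
open import Relation.Binary.PropositionalEquality using (_≡_; _≢_)
open import Relation.Nullary using (¬_; Dec; yes; no)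
open import Relation.Nullary.Decidable using (⌊_⌋; _×-dec_; ¬?)

record Graph (n : ℕ) : Set where
  field
    adj     : Fin n → Fin n → Bool
    sym     : ∀ u v → adj u v ≡ adj v u
    irrefl  : ∀ u → adj u u ≡ false
open Graph public

IsWalk : ∀ {n ℓ} → Graph n → (Fin (suc ℓ) → Fin n) → Set
IsWalk G w = ∀ q → adj G (w (inject₁ q)) (w (fsuc q)) ≡ true

Connected : ∀ {n} → Graph n → Set
Connected {n} G = ∀ u v → Σ ℕ λ ℓ → Σ (Fin (suc ℓ) → Fin n) λ w →
  IsWalk G w × w fzero ≡ u × w (fromℕ ℓ) ≡ v

HasCycle : ∀ {n} → Graph n → Set
HasCycle {n} G = Σ ℕ λ m → Σ (Fin (suc (suc (suc m))) → Fin n) λ c →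
  (∀ i j → c i ≡ c j → i ≡ j) ×
  IsWalk G c × adj G (c (fromℕ (suc (suc m)))) (c fzero) ≡ true

IsTree : ∀ {n} → Graph n → Set
IsTree G = Connected G × ¬ HasCycle G

count : ∀ {m} → (Fin m → Bool) → ℕ
count {m} p = sum (map (λ i → if p i then 1 else 0) (allFin m))

_==_ : ∀ {n} → Fin n → Fin n → Bool
a == b = ⌊ a ≟ᶠ b ⌋

_<ᵇ_ : ∀ {n} → Fin n → Fin n → Bool
a <ᵇ b = ⌊ toℕ a <? toℕ b ⌋

missingEdges : ∀ {n} → Graph n → Graph n → ℕ
missingEdges {n} T G =
  sum (map (λ u → count (λ v → (u <ᵇ v) ∧ adj T u v ∧ not (adj G u v))) (allFin n))

AllButAtMost : ∀ {n} → ℕ → Graph n → Graph n → Set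
AllButAtMost k T G = missingEdges T G ≤ k

-- DFS tour (0-based):  v : Fin (suc N) → Fin n, v₀ = v_N = r, and the
-- tour traverses each edge of T exactly twice.  Edge e_q = {v_q , v_{q+1}}.

tourN : ℕ → ℕ
tourN n = 2 * (n ∸ 1)

traversals : ∀ {n N} → (Fin (suc N) → Fin n) → Fin n → Fin n → ℕ
traversals v a b = count (λ q →
  ((v (inject₁ q) == a) ∧ (v (fsuc q) == b)) ∨
  ((v (inject₁ q) == b) ∧ (v (fsuc q) == a)))

record DFSTour {n} (T : Graph n) (r : Fin n)
               (v : Fin (suc (tourN n)) → Fin n) : Set where
  field
    start     : v fzero ≡ r
    end       : v (fromℕ (tourN n)) ≡ r
    walk      : IsWalk T v
    twiceEach : ∀ a b → adj T a b ≡ true → traversals v a b ≡ 2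

-- cyclic successor on Fin N (the 0-based form of q ↦ (q mod N) + 1)

next : ∀ {N} → Fin N → Fin N
next {suc m} q = fromℕ< (m%n<n (suc (toℕ q)) (suc m))

inInterval : ∀ {N} → Fin N → Fin N → Fin N → Bool
inInterval i j x =
  if ⌊ toℕ i ≤? toℕ j ⌋
  then ⌊ toℕ i ≤? toℕ x ⌋ ∧ ⌊ toℕ x ≤? toℕ j ⌋
  else ⌊ toℕ i ≤? toℕ x ⌋ ∨ ⌊ toℕ x ≤? toℕ j ⌋

interval : ∀ {N} → Fin N → Fin N → Subset N
interval i j = tabulate (inInterval i j)

-- Roundabout exploration process.
-- Snapshots G_1,…,G_N are given as  G : Fin N → Graph n  with G_t = G (t-1).

module Roundabout {n : ℕ} (v : Fin (suc (tourN n)) → Fin n)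
                  (G : Fin (tourN n) → Graph n) where

  N : ℕ
  N = tourN n

  edgeIn : Fin N → Fin N → Bool
  edgeIn t q = adj (G t) (v (inject₁ q)) (v (fsuc q))

  -- state s_i(t); for t > N the agent no longer moves (irrelevant)
  state : Fin N → ℕ → Fin N
  state i zero = i
  state i (suc t) with suc t ≤? N
  ... | yes p = if edgeIn (fromℕ< p) (state i t) then next (state i t) else state i t
  ... | no _  = state i t

  D : ℕ → Fin N → Subset N
  D t i = interval i (state i t)

  Redundant : ℕ → Subset N → Fin N → Set
  Redundant t S i =
    D t i ⊆ ⋃ (map (D t) (filter (λ j → (j ∈? S) ×-dec ¬? (j ≟ᶠ i)) (allFin N)))

  data Elim (t : ℕ) : Subset N → Subset N → Set where
    stop   : ∀ {S} → (∀ i → i ∈ S → ¬ Redundant t S i) → Elim t S S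
    remove : ∀ {S S'} i → i ∈ S → Redundant t S i → Elim t (S - i) S' → Elim t S S'

  IsRun : (ℕ → Subset N) → Set
  IsRun A = A 0 ≡ ⊤ × (∀ t → suc t ≤ N → Elim (suc t) (A t) (A (suc t)))

  sumOver : Subset N → (Fin N → ℕ) → ℕ
  sumOver S f = sum (map (λ i → if lookup S i then f i else 0) (allFin N))

{-# OPTIONS --safe #-}
-- Only the elimination phase at time t matters. After it, no surviving interval D_i(t) = [i, s_i(t)] lies in the union of the others,
-- and every such irredundant family of circular intervals with distinct starting points i ∈ S
-- on a circle of N points has Σ_{i∈S} |D_i| + |S| ≤ 2N. Double count:
-- Σ_{i∈S} |D_i| = Σ_x μ(x), where μ(x) is the number of intervals containing x, and
-- |S| = Σ_x [x+1 ∈ S], so it is enough that μ(x) + [x+1 ∈ S] ≤ 2 for every point x.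
-- Of three intervals through x, the one that neither starts earliest nor ends latest lies in
-- the union of the other two. If x+1 ∈ S and D_{x+1} contains x, then D_{x+1} is the whole
-- circle; otherwise, for two intervals through x, either D_{x+1} lies in the one starting
-- later, or that one lies in the union of D_{x+1} and the one starting earlier.
module Submission where

open import Defs hiding (sym)
open import Data.Nat.Properties hiding (_≟_; suc-injective)
open import Algebra.Properties.CommutativeMonoid.Sum +-0-commutativeMonoid
  using (sum-syntax; sum-cong-≗; ∑-distrib-+; ∑-comm; sum-init-last; sum-replicate-zero)
open import Data.Bool using (Bool; true; false; if_then_else_; _∧_)
open import Data.Empty using (⊥; ⊥-elim)
open import Data.Fin using (Fin; zero; suc; toℕ; fromℕ; inject₁)
open import Data.Fin.Properties
  using (_≟_; toℕ-injective; toℕ<n; toℕ-fromℕ<; toℕ-fromℕ; toℕ-inject₁; suc-injective)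
open import Data.Fin.Subset using (Subset; ∣_∣; _∈_; _∉_; ⋃)
open import Data.Fin.Subset.Properties using (_∈?_; x∈p∪q⁺)
open import Data.List using (List; allFin)
import Data.List as List
import Data.List.Properties as List
open import Data.List.Relation.Unary.Any using (here; there)
import Data.List.Membership.Propositional as List
open import Data.List.Membership.Propositional.Properties using (∈-map⁺; ∈-filter⁺; ∈-allFin)
open import Data.Nat using (ℕ; zero; suc; _+_; _*_; _∸_; _≤_; _<_; _≤?_; _<?_; z≤n; s≤s; s≤s⁻¹)
open import Data.Nat.DivMod using (_%_; m%n<n; n%n≡0; m<n⇒m%n≡m)
import Data.Nat.ListAction as ListAction
open import Data.Product using (_×_; _,_; ∃-syntax)
open import Data.Sum using (_⊎_; inj₁; inj₂)
open import Data.Vec using (_∷_; []; lookup)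
open import Data.Vec.Properties using (lookup∘tabulate; []=⇒lookup; lookup⇒[]=)
open import Function using (_∘_; id)
open import Relation.Binary.PropositionalEquality
open import Relation.Nullary using (¬_; yes; no)
open import Relation.Nullary.Decidable using (⌊_⌋; _×-dec_; ¬?)

χ : Bool → ℕ
χ b = if b then 1 else 0

sum-tabulate : ∀ {n} (f : Fin n → ℕ) → ListAction.sum (List.tabulate f) ≡ ∑[ i < n ] f i
sum-tabulate {zero}  f = refl
sum-tabulate {suc n} f = cong (f zero +_) (sum-tabulate (f ∘ suc))

sum-map-allFin : ∀ {n} (f : Fin n → ℕ) → ListAction.sum (List.map f (allFin n)) ≡ ∑[ i < n ] f i
sum-map-allFin f = trans (cong ListAction.sum (List.map-tabulate id f)) (sum-tabulate f)

∣p∣≡∑χ : ∀ {n} (p : Subset n) → ∣ p ∣ ≡ ∑[ i < n ] χ (lookup p i)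
∣p∣≡∑χ []          = refl
∣p∣≡∑χ (true ∷ p)  = cong suc (∣p∣≡∑χ p)
∣p∣≡∑χ (false ∷ p) = ∣p∣≡∑χ p

∑-≤-* : ∀ {n c} {f : Fin n → ℕ} → (∀ i → f i ≤ c) → ∑[ i < n ] f i ≤ n * c
∑-≤-* {zero}  f≤c = z≤n
∑-≤-* {suc n} f≤c = +-mono-≤ (f≤c zero) (∑-≤-* (f≤c ∘ suc))

count≡0 : ∀ {n} (P : Fin n → Bool) → (∀ i → P i ≢ true) → ∑[ i < n ] χ (P i) ≡ 0
count≡0 {zero}  P none = refl
count≡0 {suc n} P none with P zero | none zero
... | true  | ¬P₀ = ⊥-elim (¬P₀ refl)
... | false | _   = count≡0 (P ∘ suc) (none ∘ suc)

count≤1 : ∀ {n} (P : Fin n → Bool) →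
          (∀ {i j} → P i ≡ true → P j ≡ true → i ≢ j → ⊥) → ∑[ i < n ] χ (P i) ≤ 1
count≤1 {zero}  P one = z≤n
count≤1 {suc n} P one with P zero in P₀
... | true  = ≤-reflexive (cong suc (count≡0 (P ∘ suc) (λ i Pi → one P₀ Pi λ ())))
... | false = count≤1 (P ∘ suc) (λ Pi Pj i≢j → one Pi Pj (i≢j ∘ suc-injective))

count≤2 : ∀ {n} (P : Fin n → Bool) →
          (∀ {i j k} → P i ≡ true → P j ≡ true → P k ≡ true → i ≢ j → i ≢ k → j ≢ k → ⊥) →
          ∑[ i < n ] χ (P i) ≤ 2
count≤2 {zero}  P two = z≤n
count≤2 {suc n} P two with P zero in P₀
... | true  = s≤s (count≤1 (P ∘ suc) λ Pi Pj i≢j →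
                two P₀ Pi Pj (λ ()) (λ ()) (i≢j ∘ suc-injective))
... | false = count≤2 (P ∘ suc) λ Pi Pj Pk i≢j i≢k j≢k →
                two Pi Pj Pk (i≢j ∘ suc-injective) (i≢k ∘ suc-injective) (j≢k ∘ suc-injective)

lookup-∧⇒∈ : ∀ {n} {p q : Subset n} {i j} → lookup p i ∧ lookup q j ≡ true → i ∈ p × j ∈ q
lookup-∧⇒∈ {p = p} {q} {i} {j} h with lookup p i in p[i] | lookup q j in q[j]
... | true | true = lookup⇒[]= i p p[i] , lookup⇒[]= j q q[j]

x∈⋃⁺ : ∀ {n} {ps : List (Subset n)} {p x} → p List.∈ ps → x ∈ p → x ∈ ⋃ ps
x∈⋃⁺ (here refl)  x∈p = x∈p∪q⁺ (inj₁ x∈p)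
x∈⋃⁺ (there p∈ps) x∈p = x∈p∪q⁺ (inj₂ (x∈⋃⁺ p∈ps x∈p))

toℕ-next : ∀ {m} (x : Fin (suc m)) → toℕ (next x) ≡ suc (toℕ x) % suc m
toℕ-next {m} x = toℕ-fromℕ< (m%n<n (suc (toℕ x)) (suc m))

toℕ-next-cases : ∀ {m} (x : Fin (suc m)) →
                 toℕ (next x) ≡ suc (toℕ x) ⊎ toℕ x ≡ m × toℕ (next x) ≡ 0
toℕ-next-cases {m} x with suc (toℕ x) <? suc m
... | yes x<m = inj₁ (trans (toℕ-next x) (m<n⇒m%n≡m x<m))
... | no  x≮m =
  inj₂ (x≡m , trans (toℕ-next x) (trans (cong (λ k → suc k % suc m) x≡m) (n%n≡0 (suc m))))
  where
  x≡m : toℕ x ≡ m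
  x≡m = ≤-antisym (s≤s⁻¹ (toℕ<n x)) (s≤s⁻¹ (≮⇒≥ x≮m))

next-inject₁ : ∀ {m} (x : Fin m) → next (inject₁ x) ≡ suc x
next-inject₁ {m} x = toℕ-injective (begin
  toℕ (next (inject₁ x))        ≡⟨ toℕ-next (inject₁ x) ⟩
  suc (toℕ (inject₁ x)) % suc m ≡⟨ cong (λ k → suc k % suc m) (toℕ-inject₁ x) ⟩
  suc (toℕ x) % suc m           ≡⟨ m<n⇒m%n≡m (s≤s (toℕ<n x)) ⟩
  suc (toℕ x)                   ∎)
  where open ≡-Reasoning

next-fromℕ : ∀ m → next (fromℕ m) ≡ zero
next-fromℕ m = toℕ-injective (begin
  toℕ (next (fromℕ m))        ≡⟨ toℕ-next (fromℕ m) ⟩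
  suc (toℕ (fromℕ m)) % suc m ≡⟨ cong (λ k → suc k % suc m) (toℕ-fromℕ m) ⟩
  suc m % suc m               ≡⟨ n%n≡0 (suc m) ⟩
  0                           ∎)
  where open ≡-Reasoning

∑-next : ∀ {m} (f : Fin (suc m) → ℕ) → ∑[ x < suc m ] f (next x) ≡ ∑[ x < suc m ] f x
∑-next {m} f = begin
  ∑[ x < suc m ] f (next x)                            ≡⟨ sum-init-last (f ∘ next) ⟩
  ∑[ x < m ] f (next (inject₁ x)) + f (next (fromℕ m)) ≡⟨ cong₂ _+_ (sum-cong-≗ (cong f ∘ next-inject₁))
                                                                     (cong f (next-fromℕ m)) ⟩
  ∑[ x < m ] f (suc x) + f zero                        ≡⟨ +-comm _ (f zero) ⟩
  ∑[ x < suc m ] f x                                   ∎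
  where open ≡-Reasoning

-- Cyclic distance

offset-sum : ∀ a b c {X Y Z p q r e} →
             a + X ≡ p + b → b + Y ≡ q + c → a + Z ≡ r + c → p + q ≡ r + e → X + Y ≡ Z + e
offset-sum a b c {X} {Y} {Z} {p} {q} {r} {e} a+X b+Y a+Z p+q = +-cancelˡ-≡ a (X + Y) (Z + e) (begin
  a + (X + Y)   ≡⟨ +-assoc a X Y ⟨
  a + X + Y     ≡⟨ cong (_+ Y) a+X ⟩
  p + b + Y     ≡⟨ +-assoc p b Y ⟩
  p + (b + Y)   ≡⟨ cong (p +_) b+Y ⟩
  p + (q + c)   ≡⟨ +-assoc p q c ⟨
  p + q + c     ≡⟨ cong (_+ c) p+q ⟩
  r + e + c     ≡⟨ +-assoc r e c ⟩
  r + (e + c)   ≡⟨ cong (r +_) (+-comm e c) ⟩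
  r + (c + e)   ≡⟨ +-assoc r c e ⟨
  r + c + e     ≡⟨ cong (_+ e) a+Z ⟨
  a + Z + e     ≡⟨ +-assoc a Z e ⟩
  a + (Z + e)   ∎)
  where open ≡-Reasoning

m∸o≤n∸o⇒m≤n : ∀ {m n o} → o ≤ n → m ∸ o ≤ n ∸ o → m ≤ n
m∸o≤n∸o⇒m≤n {m} {n} {o} o≤n le =
  ≤-trans (m≤n+m∸n m o) (subst (o + (m ∸ o) ≤_) (m+[n∸m]≡n o≤n) (+-monoʳ-≤ o le))

m+n≡o+p⇒n<p⇒o<m : ∀ {m n o p} → m + n ≡ o + p → n < p → o < m
m+n≡o+p⇒n<p⇒o<m {m} {n} {o} {p} eq n<p = +-cancelʳ-< p o m (subst (_< m + p) eq (+-monoʳ-< m n<p))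

module _ {N : ℕ} where

  toℕ≤N+ : ∀ (i : Fin N) k → toℕ i ≤ N + k
  toℕ≤N+ i k = ≤-trans (<⇒≤ (toℕ<n i)) (m≤m+n N k)

  dist : Fin N → Fin N → ℕ
  dist i j = if ⌊ toℕ i ≤? toℕ j ⌋ then toℕ j ∸ toℕ i else N + toℕ j ∸ toℕ i

  data DistSpec (i j : Fin N) (d : ℕ) : Set where
    direct  : toℕ i ≤ toℕ j → toℕ i + d ≡ toℕ j → DistSpec i j d
    wrapped : toℕ j < toℕ i → toℕ i + d ≡ N + toℕ j → DistSpec i j d

  dist-spec : ∀ i j → DistSpec i j (dist i j)
  dist-spec i j with toℕ i ≤? toℕ j
  ... | yes i≤j = direct i≤j (m+[n∸m]≡n i≤j)
  ... | no  i≰j = wrapped (≰⇒> i≰j) (m+[n∸m]≡n (toℕ≤N+ i (toℕ j)))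

  dist<N : ∀ i j → dist i j < N
  dist<N i j with dist-spec i j
  ... | direct _ i+d    = ≤-<-trans (subst (dist i j ≤_) i+d (m≤n+m (dist i j) (toℕ i))) (toℕ<n j)
  ... | wrapped j<i i+d = +-cancelˡ-< (toℕ i) (dist i j) N
          (subst (_< toℕ i + N) (sym i+d) (subst (N + toℕ j <_) (+-comm N (toℕ i)) (+-monoʳ-< N j<i)))

  dist-self : ∀ i → dist i i ≡ 0
  dist-self i with toℕ i ≤? toℕ i
  ... | yes _   = n∸n≡0 (toℕ i)
  ... | no  i≰i = ⊥-elim (i≰i ≤-refl)

  dist≡0⇒≡ : ∀ {i j} → dist i j ≡ 0 → i ≡ j
  dist≡0⇒≡ {i} {j} d≡0 with dist i j | dist-spec i j
  dist≡0⇒≡ {i} {j} refl | _ | direct _ i+0  = toℕ-injective (trans (sym (+-identityʳ (toℕ i))) i+0)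
  dist≡0⇒≡ {i} {j} refl | _ | wrapped _ i+0 = ⊥-elim (<⇒≱ (toℕ<n i)
    (subst (N ≤_) (trans (sym i+0) (+-identityʳ (toℕ i))) (m≤m+n N (toℕ j))))

  dist-triangle : ∀ i j k → dist i j + dist j k ≡ dist i k ⊎ dist i j + dist j k ≡ dist i k + N
  dist-triangle i j k = triangle (dist-spec i j) (dist-spec j k) (dist-spec i k)
    where
    offsets : ∀ {X Y Z p q r e} → toℕ i + X ≡ p + toℕ j → toℕ j + Y ≡ q + toℕ k →
              toℕ i + Z ≡ r + toℕ k → p + q ≡ r + e → X + Y ≡ Z + e
    offsets = offset-sum (toℕ i) (toℕ j) (toℕ k)
    triangle : ∀ {d₁ d₂ d₃} → DistSpec i j d₁ → DistSpec j k d₂ → DistSpec i k d₃ →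
               d₁ + d₂ ≡ d₃ ⊎ d₁ + d₂ ≡ d₃ + N
    triangle (direct _ e₁)   (direct _ e₂)   (direct _ e₃)   =
      inj₁ (trans (offsets e₁ e₂ e₃ refl) (+-identityʳ _))
    triangle (direct i≤j _)  (direct j≤k _)  (wrapped k<i _) = ⊥-elim (<⇒≱ k<i (≤-trans i≤j j≤k))
    triangle (direct _ e₁)   (wrapped _ e₂)  (direct _ e₃)   = inj₂ (offsets e₁ e₂ e₃ refl)
    triangle (direct _ e₁)   (wrapped _ e₂)  (wrapped _ e₃)  =
      inj₁ (trans (offsets e₁ e₂ e₃ (sym (+-identityʳ N))) (+-identityʳ _))
    triangle (wrapped _ e₁)  (direct _ e₂)   (direct _ e₃)   = inj₂ (offsets e₁ e₂ e₃ (+-identityʳ N))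
    triangle (wrapped _ e₁)  (direct _ e₂)   (wrapped _ e₃)  =
      inj₁ (trans (offsets e₁ e₂ e₃ refl) (+-identityʳ _))
    triangle (wrapped j<i _) (wrapped k<j _) (direct i≤k _)  = ⊥-elim (<⇒≱ (<-trans k<j j<i) i≤k)
    triangle (wrapped _ e₁)  (wrapped _ e₂)  (wrapped _ e₃)  = inj₂ (offsets e₁ e₂ e₃ refl)

  inInterval⇒dist≤ : ∀ i j y → inInterval i j y ≡ true → dist i y ≤ dist i j
  inInterval⇒dist≤ i j y h with toℕ i ≤? toℕ j | toℕ i ≤? toℕ y | toℕ y ≤? toℕ j
  inInterval⇒dist≤ i j y h  | yes _ | yes _ | yes y≤j = ∸-monoˡ-≤ (toℕ i) y≤j
  inInterval⇒dist≤ i j y () | yes _ | yes _ | no  _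
  inInterval⇒dist≤ i j y () | yes _ | no  _ | _
  inInterval⇒dist≤ i j y h  | no  _ | yes _ | _       = ∸-monoˡ-≤ (toℕ i) (toℕ≤N+ y (toℕ j))
  inInterval⇒dist≤ i j y h  | no  _ | no  _ | yes y≤j = ∸-monoˡ-≤ (toℕ i) (+-monoʳ-≤ N y≤j)
  inInterval⇒dist≤ i j y () | no  _ | no  _ | no  _

  dist≤⇒inInterval : ∀ i j y → dist i y ≤ dist i j → inInterval i j y ≡ true
  dist≤⇒inInterval i j y le with toℕ i ≤? toℕ j | toℕ i ≤? toℕ y | toℕ y ≤? toℕ j
  ... | yes _   | yes _ | yes _   = refl
  ... | yes i≤j | yes _ | no  y≰j = ⊥-elim (y≰j (m∸o≤n∸o⇒m≤n i≤j le))
  ... | yes i≤j | no  _ | _       =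
    ⊥-elim (<⇒≱ (toℕ<n j) (≤-trans (m≤m+n N (toℕ y)) (m∸o≤n∸o⇒m≤n i≤j le)))
  ... | no  _   | yes _ | _       = refl
  ... | no  _   | no  _ | yes _   = refl
  ... | no  _   | no  _ | no  y≰j =
    ⊥-elim (y≰j (+-cancelˡ-≤ N _ _ (m∸o≤n∸o⇒m≤n (toℕ≤N+ i (toℕ j)) le)))

  ∈-interval⇒dist≤ : ∀ i j {y : Fin N} → y ∈ interval i j → dist i y ≤ dist i j
  ∈-interval⇒dist≤ i j {y} y∈ =
    inInterval⇒dist≤ i j y (trans (sym (lookup∘tabulate (inInterval i j) y)) ([]=⇒lookup y∈))

  dist≤⇒∈-interval : ∀ i j {y : Fin N} → dist i y ≤ dist i j → y ∈ interval i j
  dist≤⇒∈-interval i j {y} le =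
    lookup⇒[]= y (interval i j) (trans (lookup∘tabulate (inInterval i j) y) (dist≤⇒inInterval i j y le))

  dist-through : ∀ i j {x : Fin N} → x ∈ interval i j → dist i x + dist x j ≡ dist i j
  dist-through i j {x} x∈ with dist-triangle i x j
  ... | inj₁ eq = eq
  ... | inj₂ eq = ⊥-elim (<-irrefl eq (+-mono-≤-< (∈-interval⇒dist≤ i j x∈) (dist<N x j)))

  ∈-interval-through⁻ : ∀ i j {x y : Fin N} → x ∈ interval i j → y ∈ interval i j →
                        dist y x ≤ dist i x ⊎ dist x y ≤ dist x j
  ∈-interval-through⁻ i j {x} {y} x∈ y∈ with dist-triangle i y x | dist-triangle i x y
  ... | inj₁ iyx | _        = inj₁ (subst (dist y x ≤_) iyx (m≤n+m (dist y x) (dist i y)))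
  ... | inj₂ iyx | inj₁ ixy = inj₂ (+-cancelˡ-≤ (dist i x) _ _
          (subst₂ _≤_ (sym ixy) (sym (dist-through i j x∈)) (∈-interval⇒dist≤ i j y∈)))
  ... | inj₂ iyx | inj₂ ixy =
          ⊥-elim (<-asym (m+n≡o+p⇒n<p⇒o<m iyx (dist<N y x)) (m+n≡o+p⇒n<p⇒o<m ixy (dist<N x y)))

  ∈-interval-throughˡ : ∀ i j {x y : Fin N} → x ∈ interval i j →
                        dist y x ≤ dist i x → y ∈ interval i j
  ∈-interval-throughˡ i j {x} {y} x∈ yx≤ix with dist-triangle i y x
  ... | inj₁ eq = dist≤⇒∈-interval i j
          (≤-trans (subst (dist i y ≤_) eq (m≤m+n (dist i y) (dist y x))) (∈-interval⇒dist≤ i j x∈))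
  ... | inj₂ eq = ⊥-elim (<-irrefl eq
          (subst (dist i y + dist y x <_) (+-comm N (dist i x)) (+-mono-<-≤ (dist<N i y) yx≤ix)))

  ∈-interval-throughʳ : ∀ i j {x y : Fin N} → x ∈ interval i j →
                        dist x y ≤ dist x j → y ∈ interval i j
  ∈-interval-throughʳ i j {x} {y} x∈ xy≤xj = by-triangle (dist-triangle i x y)
    where
    ix+xy≤ij : dist i x + dist x y ≤ dist i j
    ix+xy≤ij = subst (dist i x + dist x y ≤_) (dist-through i j x∈) (+-monoʳ-≤ (dist i x) xy≤xj)
    by-triangle : dist i x + dist x y ≡ dist i y ⊎ dist i x + dist x y ≡ dist i y + N → y ∈ interval i j
    by-triangle (inj₁ eq) = dist≤⇒∈-interval i j (subst (_≤ dist i j) eq ix+xy≤ij)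
    by-triangle (inj₂ eq) =
      ⊥-elim (<⇒≱ (≤-<-trans ix+xy≤ij (dist<N i j)) (subst (N ≤_) (sym eq) (m≤n+m N (dist i y))))

dist-next : ∀ {m} (x : Fin (suc (suc m))) → dist x (next x) ≡ 1
dist-next {m} x with dist-spec x (next x) | toℕ-next-cases x
... | direct _ e     | inj₁ nx≡         =
  +-cancelˡ-≡ (toℕ x) _ 1 (trans e (trans nx≡ (+-comm 1 (toℕ x))))
... | direct x≤nx _  | inj₂ (x≡ , nx≡0) = ⊥-elim (n≮0 (subst₂ _≤_ x≡ nx≡0 x≤nx))
... | wrapped nx<x _ | inj₁ nx≡         =
  ⊥-elim (n≮n (toℕ x) (<-trans (n<1+n (toℕ x)) (subst (_< toℕ x) nx≡ nx<x)))
... | wrapped _ e    | inj₂ (x≡ , nx≡0) = +-cancelˡ-≡ (suc m) _ 1 (begin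
  suc m + dist x (next x)    ≡⟨ cong (_+ dist x (next x)) x≡ ⟨
  toℕ x + dist x (next x)    ≡⟨ e ⟩
  suc (suc m) + toℕ (next x) ≡⟨ cong (suc (suc m) +_) nx≡0 ⟩
  suc (suc m) + 0            ≡⟨ +-identityʳ _ ⟩
  suc (suc m)                ≡⟨ +-comm 1 (suc m) ⟩
  suc m + 1                  ∎)
  where open ≡-Reasoning

dist-next-triangle : ∀ {m} (x y : Fin (suc (suc m))) →
  suc (dist (next x) y) ≡ dist x y ⊎ suc (dist (next x) y) ≡ dist x y + suc (suc m)
dist-next-triangle x y =
  subst (λ d → d + dist (next x) y ≡ dist x y ⊎ d + dist (next x) y ≡ dist x y + _)
        (dist-next x) (dist-triangle x (next x) y)

suc-dist-next : ∀ {m} {x y : Fin (suc m)} → y ≢ x → suc (dist (next x) y) ≡ dist x y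
suc-dist-next {zero}  {zero} {zero} y≢x = ⊥-elim (y≢x refl)
suc-dist-next {suc m} {x}    {y}    y≢x with dist-next-triangle x y
... | inj₁ eq = eq
... | inj₂ eq = ⊥-elim (y≢x (sym (dist≡0⇒≡ (n≤0⇒n≡0
        (+-cancelʳ-≤ (suc (suc m)) (dist x y) 0 (subst (_≤ suc (suc m)) eq (dist<N (next x) y)))))))

suc-dist-next-self : ∀ {m} (x : Fin (suc m)) → suc (dist (next x) x) ≡ suc m
suc-dist-next-self {zero}  zero = refl
suc-dist-next-self {suc m} x with dist-next-triangle x x
... | inj₁ eq = ⊥-elim (1+n≢0 (trans eq (dist-self x)))
... | inj₂ eq = trans eq (cong (_+ suc (suc m)) (dist-self x))

∈-interval-next-all : ∀ {m} {x j : Fin (suc m)} → x ∈ interval (next x) j →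
                      ∀ y → y ∈ interval (next x) j
∈-interval-next-all {m} {x} {j} x∈ y =
  dist≤⇒∈-interval (next x) j (≤-trans y≤x (∈-interval⇒dist≤ (next x) j x∈))
  where
  y≤x : dist (next x) y ≤ dist (next x) x
  y≤x = s≤s⁻¹ (subst (dist (next x) y <_) (sym (suc-dist-next-self x)) (dist<N (next x) y))

∈-interval-next⁻ : ∀ {m} {x y j : Fin (suc m)} → y ≢ x →
                   y ∈ interval (next x) j → dist x y ≤ suc (dist (next x) j)
∈-interval-next⁻ {x = x} {j = j} y≢x y∈ =
  subst (_≤ _) (suc-dist-next y≢x) (s≤s (∈-interval⇒dist≤ (next x) j y∈))

∈-interval-next⁺ : ∀ {m} {x y j : Fin (suc m)} → y ≢ x →
                   dist x y ≤ suc (dist (next x) j) → y ∈ interval (next x) j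
∈-interval-next⁺ {x = x} {j = j} y≢x le =
  dist≤⇒∈-interval (next x) j (s≤s⁻¹ (subst (_≤ _) (sym (suc-dist-next y≢x)) le))

-- Irredundant families of circular intervals

module _ {A : Set} (P : A → Set) (f g : A → ℕ) where

  undominated⇒¬three-distinct :
    (∀ {γ α β} → P γ → P α → P β → α ≢ γ → β ≢ γ → f γ ≤ f α → g γ ≤ g β → ⊥) →
    ∀ {a b c} → P a → P b → P c → a ≢ b → a ≢ c → b ≢ c → ⊥
  undominated⇒¬three-distinct undominated {a} {b} {c} pa pb pc a≢b a≢c b≢c =
    by-maximum (≤-total (f b) (f a))
    where
    with-f-maximum : ∀ {α u w} → P α → P u → P w → α ≢ u → α ≢ w → u ≢ w →
                     f u ≤ f α → f w ≤ f α → ⊥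
    with-f-maximum {u = u} {w} pα pu pw α≢u α≢w u≢w fu≤fα fw≤fα with ≤-total (g u) (g w)
    ... | inj₁ gu≤gw = undominated pu pα pw α≢u (≢-sym u≢w) fu≤fα gu≤gw
    ... | inj₂ gw≤gu = undominated pw pα pu α≢w u≢w fw≤fα gw≤gu
    by-maximum : f b ≤ f a ⊎ f a ≤ f b → ⊥
    by-maximum (inj₁ fb≤fa) with ≤-total (f c) (f a)
    ... | inj₁ fc≤fa = with-f-maximum pa pb pc a≢b a≢c b≢c fb≤fa fc≤fa
    ... | inj₂ fa≤fc =
      with-f-maximum pc pa pb (≢-sym a≢c) (≢-sym b≢c) a≢b fa≤fc (≤-trans fb≤fa fa≤fc)
    by-maximum (inj₂ fa≤fb) with ≤-total (f c) (f b)
    ... | inj₁ fc≤fb = with-f-maximum pb pa pc (≢-sym a≢b) b≢c a≢c fa≤fb fc≤fb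
    ... | inj₂ fb≤fc =
      with-f-maximum pc pa pb (≢-sym a≢c) (≢-sym b≢c) a≢b (≤-trans fa≤fb fb≤fc) fb≤fc

module IntervalFamily {N : ℕ} (s : Fin N → Fin N) (S : Subset N) where

  D : Fin N → Subset N
  D i = interval i (s i)

  Covered : Fin N → Set
  Covered γ = ∀ {y} → y ∈ D γ → ∃[ j ] (j ∈ S × j ≢ γ × y ∈ D j)

  Irredundant : Set
  Irredundant = ∀ {γ} → γ ∈ S → ¬ Covered γ

  covered-by-two : ∀ {x α β γ} → α ∈ S → β ∈ S → α ≢ γ → β ≢ γ →
                   x ∈ D α → x ∈ D β → x ∈ D γ →
                   dist γ x ≤ dist α x → dist x (s γ) ≤ dist x (s β) → Covered γ
  covered-by-two {x} {α} {β} {γ} α∈S β∈S α≢γ β≢γ x∈α x∈β x∈γ γα γβ y∈γ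
    with ∈-interval-through⁻ γ (s γ) x∈γ y∈γ
  ... | inj₁ yx≤γx = α , α∈S , α≢γ , ∈-interval-throughˡ α (s α) x∈α (≤-trans yx≤γx γα)
  ... | inj₂ xy≤xγ = β , β∈S , β≢γ , ∈-interval-throughʳ β (s β) x∈β (≤-trans xy≤xγ γβ)

  ¬three-distinct-cover : Irredundant → ∀ {x a b c} → a ∈ S → b ∈ S → c ∈ S →
                          x ∈ D a → x ∈ D b → x ∈ D c → a ≢ b → a ≢ c → b ≢ c → ⊥
  ¬three-distinct-cover irredundant {x} a∈S b∈S c∈S x∈a x∈b x∈c =
    undominated⇒¬three-distinct (λ i → i ∈ S × x ∈ D i) (λ i → dist i x) (λ i → dist x (s i))
      (λ (γ∈S , x∈γ) (α∈S , x∈α) (β∈S , x∈β) α≢γ β≢γ γα γβ →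
         irredundant γ∈S (covered-by-two α∈S β∈S α≢γ β≢γ x∈α x∈β x∈γ γα γβ))
      (a∈S , x∈a) (b∈S , x∈b) (c∈S , x∈c)

  covers : Fin N → Fin N → Bool
  covers i x = lookup S i ∧ lookup (D i) x

  covers⇒∈ : ∀ {i x} → covers i x ≡ true → i ∈ S × x ∈ D i
  covers⇒∈ {i} = lookup-∧⇒∈ {p = S} {q = D i}

  multiplicity : Fin N → ℕ
  multiplicity x = ∑[ i < N ] χ (covers i x)

  ∑-sizes≡∑-multiplicity : ∑[ i < N ] (if lookup S i then ∣ D i ∣ else 0) ≡ ∑[ x < N ] multiplicity x
  ∑-sizes≡∑-multiplicity = trans (sum-cong-≗ size≡) (∑-comm (λ i x → χ (covers i x)))
    where
    size≡ : ∀ i → (if lookup S i then ∣ D i ∣ else 0) ≡ ∑[ x < N ] χ (covers i x)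
    size≡ i with lookup S i
    ... | true  = ∣p∣≡∑χ (D i)
    ... | false = sym (sum-replicate-zero N)

module _ {m : ℕ} (s : Fin (suc m) → Fin (suc m)) (S : Subset (suc m)) where
  open IntervalFamily s S

  covered-by-whole : ∀ {x b} → next x ∈ S → x ∈ D (next x) → b ≢ next x → Covered b
  covered-by-whole {x} next∈S x∈next b≢next {y} _ =
    next x , next∈S , ≢-sym b≢next , ∈-interval-next-all x∈next y

  covered-next-by-later : ∀ {x b} → b ∈ S → x ∉ D (next x) → x ∈ D b →
                          suc (dist (next x) (s (next x))) ≤ dist x (s b) → Covered (next x)
  covered-next-by-later {x} {b} b∈S x∉next x∈b reach≤ {y} y∈next =
    b , b∈S , b≢next ,
    ∈-interval-throughʳ b (s b) x∈b (≤-trans (∈-interval-next⁻ y≢x y∈next) reach≤)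
    where
    y≢x : y ≢ x
    y≢x refl = x∉next y∈next
    b≢next : b ≢ next x
    b≢next refl = x∉next x∈b

  covered-by-earlier-and-next : ∀ {x a b} → a ∈ S → next x ∈ S → a ≢ b → x ∉ D (next x) →
                                x ∈ D a → x ∈ D b → dist b x ≤ dist a x →
                                dist x (s b) ≤ suc (dist (next x) (s (next x))) → Covered b
  covered-by-earlier-and-next {x} {a} {b} a∈S next∈S a≢b x∉next x∈a x∈b ba ≤reach {y} y∈b
    with ∈-interval-through⁻ b (s b) x∈b y∈b | y ≟ x
  ... | inj₁ yx≤bx | _        = a , a∈S , a≢b , ∈-interval-throughˡ a (s a) x∈a (≤-trans yx≤bx ba)
  ... | inj₂ _     | yes refl = a , a∈S , a≢b , x∈a
  ... | inj₂ xy≤xb | no y≢x   =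
    next x , next∈S , next≢b , ∈-interval-next⁺ y≢x (≤-trans xy≤xb ≤reach)
    where
    next≢b : next x ≢ b
    next≢b refl = x∉next x∈b

  module _ (irredundant : Irredundant) where

    ¬later-start : ∀ {x a b} → next x ∈ S → x ∉ D (next x) → a ∈ S → b ∈ S →
                   x ∈ D a → x ∈ D b → a ≢ b → dist b x ≤ dist a x → ⊥
    ¬later-start {x} {a} {b} next∈S x∉next a∈S b∈S x∈a x∈b a≢b ba
      with ≤-total (suc (dist (next x) (s (next x)))) (dist x (s b))
    ... | inj₁ reach≤ = irredundant next∈S (covered-next-by-later b∈S x∉next x∈b reach≤)
    ... | inj₂ ≤reach =
      irredundant b∈S (covered-by-earlier-and-next a∈S next∈S a≢b x∉next x∈a x∈b ba ≤reach)

    ¬two-distinct-cover-before-member : ∀ {x a b} → next x ∈ S → a ∈ S → b ∈ S →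
                                        x ∈ D a → x ∈ D b → a ≢ b → ⊥
    ¬two-distinct-cover-before-member {x} {a} {b} next∈S a∈S b∈S x∈a x∈b a≢b
      with x ∈? D (next x) | a ≟ next x | ≤-total (dist b x) (dist a x)
    ... | yes x∈next | yes refl  | _       = irredundant b∈S (covered-by-whole next∈S x∈next (≢-sym a≢b))
    ... | yes x∈next | no a≢next | _       = irredundant a∈S (covered-by-whole next∈S x∈next a≢next)
    ... | no x∉next  | _         | inj₁ ba = ¬later-start next∈S x∉next a∈S b∈S x∈a x∈b a≢b ba
    ... | no x∉next  | _         | inj₂ ab =
      ¬later-start next∈S x∉next b∈S a∈S x∈b x∈a (≢-sym a≢b) ab

    multiplicity≤2 : ∀ x → multiplicity x ≤ 2
    multiplicity≤2 x = count≤2 (λ i → covers i x) λ ai bi ci →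
      let (a∈S , x∈a) = covers⇒∈ {x = x} ai
          (b∈S , x∈b) = covers⇒∈ {x = x} bi
          (c∈S , x∈c) = covers⇒∈ {x = x} ci
      in ¬three-distinct-cover irredundant a∈S b∈S c∈S x∈a x∈b x∈c

    multiplicity-before-member≤1 : ∀ {x} → next x ∈ S → multiplicity x ≤ 1
    multiplicity-before-member≤1 {x} next∈S = count≤1 (λ i → covers i x) λ ai bi →
      let (a∈S , x∈a) = covers⇒∈ {x = x} ai
          (b∈S , x∈b) = covers⇒∈ {x = x} bi
      in ¬two-distinct-cover-before-member next∈S a∈S b∈S x∈a x∈b

    multiplicity+χnext≤2 : ∀ x → multiplicity x + χ (lookup S (next x)) ≤ 2
    multiplicity+χnext≤2 x with lookup S (next x) in S[next]
    ... | true  = subst (_≤ 2) (+-comm 1 _)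
                    (s≤s (multiplicity-before-member≤1 (lookup⇒[]= (next x) S S[next])))
    ... | false = subst (_≤ 2) (sym (+-identityʳ _)) (multiplicity≤2 x)

    ∑-sizes+∣S∣≤2N : ∑[ i < suc m ] (if lookup S i then ∣ D i ∣ else 0) + ∣ S ∣ ≤ 2 * suc m
    ∑-sizes+∣S∣≤2N = begin
      ∑[ i < suc m ] (if lookup S i then ∣ D i ∣ else 0) + ∣ S ∣
        ≡⟨ cong₂ _+_ ∑-sizes≡∑-multiplicity (trans (∣p∣≡∑χ S) (sym (∑-next (χ ∘ lookup S)))) ⟩
      ∑[ x < suc m ] multiplicity x + ∑[ x < suc m ] χ (lookup S (next x))
        ≡⟨ ∑-distrib-+ multiplicity (χ ∘ lookup S ∘ next) ⟨
      ∑[ x < suc m ] (multiplicity x + χ (lookup S (next x)))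
        ≤⟨ ∑-≤-* multiplicity+χnext≤2 ⟩
      suc m * 2
        ≡⟨ *-comm (suc m) 2 ⟩
      2 * suc m ∎
      where open ≤-Reasoning

module _ {n : ℕ} (v : Fin (suc (tourN n)) → Fin n) (G : Fin (tourN n) → Graph n) where
  open Roundabout v G

  sumOver≡∑ : ∀ S f → sumOver S f ≡ ∑[ i < N ] (if lookup S i then f i else 0)
  sumOver≡∑ S f = sum-map-allFin (λ i → if lookup S i then f i else 0)

  covered⇒redundant : ∀ {t S γ} → IntervalFamily.Covered (λ i → state i t) S γ → Redundant t S γ
  covered⇒redundant {t} {S} {γ} covered y∈γ with covered y∈γ
  ... | j , j∈S , j≢γ , y∈j =
    x∈⋃⁺ (∈-map⁺ (D t) (∈-filter⁺ (λ j → (j ∈? S) ×-dec ¬? (j ≟ γ)) (∈-allFin j) (j∈S , j≢γ)))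
         y∈j

  elim⇒irredundant : ∀ {t S S′} → Elim t S S′ → IntervalFamily.Irredundant (λ i → state i t) S′
  elim⇒irredundant {t} (stop final)        γ∈S = final _ γ∈S ∘ covered⇒redundant {t}
  elim⇒irredundant     (remove _ _ _ rest)     = elim⇒irredundant rest

lemma7 : (n k : ℕ) → 2 ≤ n → 1 ≤ k →
    (T : Graph n) → IsTree T → (r : Fin n) →
    (v : Fin (suc (tourN n)) → Fin n) → DFSTour T r v →
    (G : Fin (tourN n) → Graph n) → (∀ t → AllButAtMost k T (G t)) →
    (A : ℕ → Subset (tourN n)) → Roundabout.IsRun v G A →
    (t : ℕ) → 1 ≤ t → t ≤ tourN n →
    Roundabout.sumOver v G (A t) (λ i → ∣ Roundabout.D v G t i ∣)
      ≤ 2 * tourN n ∸ ∣ A t ∣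
lemma7 (suc (suc _)) _ _ _ _ _ _ v _ G _ A (_ , run) (suc t) _ t<N =
  m+n≤o⇒m≤o∸n (sumOver S size) (begin
    sumOver S size + ∣ S ∣
      ≡⟨ cong (_+ ∣ S ∣) (sumOver≡∑ v G S size) ⟩
    ∑[ i < N ] (if lookup S i then size i else 0) + ∣ S ∣
      ≤⟨ ∑-sizes+∣S∣≤2N (λ i → state i (suc t)) S irredundant ⟩
    2 * N ∎)
  where
  open Roundabout v G
  open ≤-Reasoning
  S : Subset N
  S = A (suc t)
  size : Fin N → ℕ
  size i = ∣ D (suc t) i ∣
  irredundant : IntervalFamily.Irredundant (λ i → state i (suc t)) S
  irredundant = elim⇒irredundant v G (run t t<N)
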